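{- The Diophantine equation $8^{x}-5^{x}=L_{r}$ in nonnegative integers $r,x$ has only the solution $(r,x)=(2,1)$.
   Context: $(L_n)_{n\ge0}$ is the Lucas sequence: $L_0=2$, $L_1=1$, $L_n=L_{n-1}+L_{n-2}$ for $n\ge 2$. -}

module Defs where

open import Data.Nat using (ℕ; zero; suc; _+_)

L : ℕ → ℕ
L zero = 2
L (suc zero) = 1
L (suc (suc n)) = L (suc n) + L n

module Submission where

-- Small exponents are handled directly: x = 0 would force L r = 0, but Lucas
-- numbers are positive, and x = 1 gives L r = 3, which forces r = 2 since
-- L is strictly larger than 3 from index 3 on.  For x ≥ 2 we argue modulo
-- M = 40016 = 2⁴·41·61: the residues of L r have period 120 in r and, once
-- x ≥ 2, the pair of residues (8^x , 5^x) has period 60 in x, so the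
-- congruence L r + 5^x ≡ 8^x (mod M) is decided by finitely many residue
-- classes, and a finite computation shows that none of them is a solution.

open import Defs
open import Data.Nat using (ℕ; _^_; _∸_)
open import Data.Product using (_×_)
open import Function.Bundles using (_⇔_)
open import Relation.Binary.PropositionalEquality using (_≡_)

open import Data.Bool using (Bool; true; not; _∧_; T)
open import Data.Bool.Properties using (T-∧; T-not-≡)
open import Data.Empty using (⊥-elim)
open import Data.Nat using (zero; suc; _+_; _*_; _%_; _/_; _≤_; _<_; _≡ᵇ_; NonZero; s≤s; z≤n)
open import Data.Nat.DivMod using (%-distribˡ-+; %-distribˡ-*; m%n%n≡m%n; m≡m%n+[m/n]*n; m%n<n)
open import Data.Nat.GeneralisedArithmetic using (fold; fold-+; iterate-is-fold)
open import Data.Nat.Properties using (+-comm; ≤-trans; m≤m+n; +-mono-≤; <⇒≢; ^-monoˡ-≤; m∸n+n≡m; ≡⇒≡ᵇ)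
open import Data.Product using (_,_; proj₁; proj₂)
open import Function.Bundles using (mk⇔; Equivalence)
open import Relation.Binary.PropositionalEquality using (refl; sym; trans; cong; cong₂; subst; module ≡-Reasoning)
open import Relation.Nullary using (¬_)

open Equivalence using (to)

private
  variable
    A : Set

fold-period-multiple : ∀ {p : A} {s : A → A} k → fold p s k ≡ p →
                       ∀ q → fold p s (q * k) ≡ p
fold-period-multiple k back zero = refl
fold-period-multiple {p = p} {s} k back (suc q) = begin
  fold p s (k + q * k)            ≡⟨ fold-+ p s k ⟩
  fold (fold p s (q * k)) s k     ≡⟨ cong (λ z → fold z s k) (fold-period-multiple k back q) ⟩
  fold p s k                      ≡⟨ back ⟩
  p                               ∎
  where open ≡-Reasoning

fold-mod-period : ∀ {p : A} {s : A → A} k .{{_ : NonZero k}} → fold p s k ≡ p →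
                  ∀ n → fold p s n ≡ fold p s (n % k)
fold-mod-period {p = p} {s} k back n = begin
  fold p s n                               ≡⟨ cong (fold p s) (m≡m%n+[m/n]*n n k) ⟩
  fold p s (n % k + (n / k) * k)           ≡⟨ fold-+ p s (n % k) ⟩
  fold (fold p s ((n / k) * k)) s (n % k)  ≡⟨ cong (λ z → fold z s (n % k)) (fold-period-multiple k back (n / k)) ⟩
  fold p s (n % k)                         ∎
  where open ≡-Reasoning

-- Checks a Boolean test on the first n points of an orbit; written
-- tail-recursively so that it can be evaluated by the type checker.
allAlong : (A → Bool) → (A → A) → A → ℕ → Bool
allAlong test s p zero    = true
allAlong test s p (suc n) = test p ∧ allAlong test s (s p) n

fold-shift : ∀ (p : A) s t → fold p s (suc t) ≡ fold (s p) s t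
fold-shift p s t = trans (iterate-is-fold p s (suc t)) (sym (iterate-is-fold (s p) s t))

allAlong-sound : ∀ (test : A → Bool) s p n → T (allAlong test s p n) →
                 ∀ t → t < n → T (test (fold p s t))
allAlong-sound test s p (suc n) ok zero _ = proj₁ (to T-∧ ok)
allAlong-sound test s p (suc n) ok (suc t) (s≤s t<n) =
  subst (λ z → T (test z)) (sym (fold-shift p s t))
    (allAlong-sound test s (s p) n (proj₂ (to (T-∧ {test p}) ok)) t t<n)

*-%-absorbʳ : ∀ a n m .{{_ : NonZero m}} → (a * (n % m)) % m ≡ (a * n) % m
*-%-absorbʳ a n m = begin
  (a * (n % m)) % m               ≡⟨ %-distribˡ-* a (n % m) m ⟩
  ((a % m) * (n % m % m)) % m     ≡⟨ cong (λ z → ((a % m) * z) % m) (m%n%n≡m%n n m) ⟩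
  ((a % m) * (n % m)) % m         ≡⟨ sym (%-distribˡ-* a n m) ⟩
  (a * n) % m                     ∎
  where open ≡-Reasoning

lucasStep : (m : ℕ) .{{_ : NonZero m}} → ℕ × ℕ → ℕ × ℕ
lucasStep m (u , v) = (v , (u + v) % m)

lucasStart : (m : ℕ) .{{_ : NonZero m}} → ℕ × ℕ
lucasStart m = (2 % m , 1 % m)

lucas-residues : ∀ m .{{_ : NonZero m}} n →
                 fold (lucasStart m) (lucasStep m) n ≡ (L n % m , L (suc n) % m)
lucas-residues m zero = refl
lucas-residues m (suc n) rewrite lucas-residues m n =
  cong (L (suc n) % m ,_) (begin
    (L n % m + L (suc n) % m) % m   ≡⟨ sym (%-distribˡ-+ (L n) (L (suc n)) m) ⟩
    (L n + L (suc n)) % m           ≡⟨ cong (_% m) (+-comm (L n) (L (suc n))) ⟩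
    L (suc (suc n)) % m             ∎)
  where open ≡-Reasoning

powerStep : (a b m : ℕ) .{{_ : NonZero m}} → ℕ × ℕ → ℕ × ℕ
powerStep a b m (u , v) = ((a * u) % m , (b * v) % m)

powerStart : (m : ℕ) .{{_ : NonZero m}} → ℕ × ℕ
powerStart m = (1 % m , 1 % m)

power-residues : ∀ a b m .{{_ : NonZero m}} x →
                 fold (powerStart m) (powerStep a b m) x ≡ (a ^ x % m , b ^ x % m)
power-residues a b m zero = refl
power-residues a b m (suc x) rewrite power-residues a b m x =
  cong₂ _,_ (*-%-absorbʳ a (a ^ x) m) (*-%-absorbʳ b (b ^ x) m)

M : ℕ
M = 40016

clash : ℕ × ℕ → ℕ × ℕ → Bool
clash (l , _) (u , v) = ((l + v) % M) ≡ᵇ u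

-- The power state at x = 2, from which the power residues are 60-periodic.
powerFrom2 : ℕ × ℕ
powerFrom2 = fold (powerStart M) (powerStep 8 5 M) 2

-- Lucas residues modulo M repeat after 120 steps (the least common multiple
-- of the periods 24, 40, 60 modulo 16, 41, 61); checked by evaluation.
lucas-period : fold (lucasStart M) (lucasStep M) 120 ≡ lucasStart M
lucas-period = refl

-- From x = 2 on, (8^x , 5^x) modulo M repeats after 60 steps, since
-- 8^x ≡ 0 modulo 16 there; checked by evaluation.
power-period : fold powerFrom2 (powerStep 8 5 M) 60 ≡ powerFrom2
power-period = refl

avoidsLucasResidues : ℕ × ℕ → Bool
avoidsLucasResidues q = allAlong (λ p → not (clash p q)) (lucasStep M) (lucasStart M) 120

sieve : T (allAlong avoidsLucasResidues (powerStep 8 5 M) powerFrom2 60)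
sieve = _

no-clash : ∀ r y → T (not (clash (fold (lucasStart M) (lucasStep M) r)
                                  (fold (powerStart M) (powerStep 8 5 M) (y + 2))))
no-clash r y
  rewrite fold-mod-period {p = lucasStart M} {lucasStep M} 120 lucas-period r
        | fold-+ (powerStart M) (powerStep 8 5 M) y {2}
        | fold-mod-period {p = powerFrom2} {powerStep 8 5 M} 60 power-period y =
  allAlong-sound (λ p → not (clash p powers)) (lucasStep M) (lucasStart M) 120
    (allAlong-sound avoidsLucasResidues (powerStep 8 5 M) powerFrom2 60 sieve (y % 60) (m%n<n y 60))
    (r % 120) (m%n<n r 120)
  where
  powers : ℕ × ℕ
  powers = fold powerFrom2 (powerStep 8 5 M) (y % 60)

no-large-solution : ∀ r y → ¬ (8 ^ (y + 2) ∸ 5 ^ (y + 2) ≡ L r)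
no-large-solution r y eq = subst T (to T-not-≡ (no-clash r y)) clashes
  where
  x = y + 2
  sum-eq : L r + 5 ^ x ≡ 8 ^ x
  sum-eq = subst (λ l → l + 5 ^ x ≡ 8 ^ x) eq (m∸n+n≡m (^-monoˡ-≤ x (s≤s (s≤s (s≤s (s≤s (s≤s z≤n)))))))
  clashes : T (clash (fold (lucasStart M) (lucasStep M) r) (fold (powerStart M) (powerStep 8 5 M) x))
  clashes rewrite lucas-residues M r | power-residues 8 5 M x =
    ≡⇒≡ᵇ _ _ (begin
      (L r % M + 5 ^ x % M) % M   ≡⟨ sym (%-distribˡ-+ (L r) (5 ^ x) M) ⟩
      (L r + 5 ^ x) % M           ≡⟨ cong (_% M) sum-eq ⟩
      8 ^ x % M                   ∎)
    where open ≡-Reasoning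

L-positive : ∀ n → 1 ≤ L n
L-positive zero = s≤s z≤n
L-positive (suc zero) = s≤s z≤n
L-positive (suc (suc n)) = ≤-trans (L-positive (suc n)) (m≤m+n _ _)

L-≥3 : ∀ n → 3 ≤ L (2 + n)
L-≥3 zero = s≤s (s≤s (s≤s z≤n))
L-≥3 (suc zero) = s≤s (s≤s (s≤s z≤n))
L-≥3 (suc (suc n)) = ≤-trans (L-≥3 (suc n)) (m≤m+n _ _)

-- Index 2 is the only one at which the value 3 occurs, since from index 3
-- on L (3 + n) = L (2 + n) + L (1 + n) ≥ 3 + 1.
L≡3⇒≡2 : ∀ r → L r ≡ 3 → r ≡ 2
L≡3⇒≡2 (suc (suc zero)) _ = refl
L≡3⇒≡2 (suc (suc (suc n))) eq =
  ⊥-elim (<⇒≢ (+-mono-≤ (L-≥3 n) (L-positive (suc n))) (sym eq))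

corollary4 : (r x : ℕ) → (8 ^ x ∸ 5 ^ x ≡ L r ⇔ (r ≡ 2 × x ≡ 1))
corollary4 r x = mk⇔ (solution x) (λ { (refl , refl) → refl })
  where
  solution : ∀ x → 8 ^ x ∸ 5 ^ x ≡ L r → r ≡ 2 × x ≡ 1
  solution zero eq = ⊥-elim (<⇒≢ (L-positive r) eq)
  solution (suc zero) eq = L≡3⇒≡2 r (sym eq) , refl
  solution (suc (suc y)) eq =
    ⊥-elim (no-large-solution r y (subst (λ x → 8 ^ x ∸ 5 ^ x ≡ L r) (+-comm 2 y) eq))
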